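{- Let $\Omega=(S,\Sigma,\Pi)$ be a many-sorted signature, $\mathcal{S}$ a theory over $\Omega$, $s\in S$, and let $\mathcal{A}$ be an $\Omega_{\mathit{Nat},s}$-structure which is a model of $\mathcal{S}$. Assume $\mathcal{A}_{\mathit{Nat}}=\mathbb{N}$, $\mathtt{0}^{\mathcal{A}}=0$, and for all $m,n\in\mathcal{A}_{\mathit{Nat}}$, $m>^{\mathcal{A}}n$ iff $m>n$ in $\mathbb{N}$. If $\mathcal{A}\models\mathsf{SuH}_s$, then for every $s'\in K(s)$ the map $h_{s'}$ from ground $\Sigma$-terms of sort $s'$ to $\mathcal{A}_{s'}$, $t\mapsto[t]_{\mathcal{A}}$, is surjective.
   Context: Many-sorted first-order logic with sorted signatures, structures, and the identity predicate $=$ interpreted as identity. $\Sigma_{w,s}$ is the set of function symbols $f:w\to s$; $\Sigma_{\lambda,s}$ the constants of sort $s$. The set $K(s)$ of $s$-relevant sorts is the least set with $s\in K(s)$ and such that if $f\in\Sigma_{s_1\cdots s_k,s'}$ and $s'\in K(s)$ then $s_1,\ldots,s_k\in K(s)$. The signature $\Omega_{\mathit{Nat},s}$ extends $\Omega$ with a new sort $\mathit{Nat}$, a new constant $\mathtt{0}:\lambda\to\mathit{Nat}$, a predicate $>\,:\mathit{Nat}\,\mathit{Nat}$, and a predicate $term_{s'}:s'\,\mathit{Nat}$ for each $s'\in K(s)$. $\mathsf{SuH}_s$ is the set consisting, for each $s'\in K(s)$, of the three sentences (i) $(\forall x:s')(\exists n:\mathit{Nat})\ term_{s'}(x,n)$;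 (ii) $(\forall x:s')(\forall n:\mathit{Nat})\ \big(term_{s'}(x,\mathtt{0})\Rightarrow\bigvee_{c\in\Sigma_{\lambda,s'}}x=c\big)$; (iii) $(\forall x:s')(\forall n:\mathit{Nat})(\exists m:\mathit{Nat})\ \Big((n>\mathtt{0}\wedge term_{s'}(x,n))\Rightarrow \big(n>m\wedge\big(term_{s'}(x,m)\vee\bigvee_{f\in\Sigma_{w,s'},\,w=s_1\cdots s_k\in S^+}(\exists y_1:s_1)\cdots(\exists y_k:s_k)\,(x=f(y_1,\ldots,y_k)\wedge\bigwedge_{i=1}^k term_{s_i}(y_i,m))\big)\big)\Big)$. (Empty disjunctions are false.) $[t]_{\mathcal{A}}$ denotes the value of the ground term $t$ in $\mathcal{A}$; being a model of the $\Omega$-theory $\mathcal{S}$ refers to the $\Omega$-reduct of $\mathcal{A}$. -}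

module Defs where

open import Data.List using (List; []; _∷_)
open import Data.List.Membership.Propositional using (_∈_)
open import Data.List.Relation.Unary.All as All using (All; []; _∷_)
open import Data.List.Relation.Unary.Any using (here; there)
open import Data.Nat using (ℕ; _>_)
open import Data.Product using (Σ; _×_; _,_; ∃; ∃-syntax)
open import Data.Sum using (_⊎_)
open import Data.Empty using (⊥)
open import Data.Unit using (⊤)
open import Relation.Binary.PropositionalEquality using (_≡_)
open import Relation.Nullary using (¬_)
open import Function.Bundles using (_⇔_)

-- Many-sorted signatures Ω = (S, Σ, Π).
-- Fun w s  is Σ_{w,s}  (w a word of sorts, i.e. a list);
-- constants of sort s are  Fun [] s  (= Σ_{λ,s});
-- Pred w  is Π_w.

record Signature : Set₁ where
  field
    Sort : Set
    Fun  : List Sort → Sort → Set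
    Pred : List Sort → Set
open Signature public

module _ (Ω : Signature) where

  -- Ω-structures; '=' is always interpreted as identity (≡).
  record Structure : Set₁ where
    field
      Carrier : Sort Ω → Set
      fun     : ∀ {w s} → Fun Ω w s → All Carrier w → Carrier s
      pred    : ∀ {w} → Pred Ω w → All Carrier w → Set
  open Structure public

  data Term  (Γ : List (Sort Ω)) : Sort Ω → Set
  data Terms (Γ : List (Sort Ω)) : List (Sort Ω) → Set

  data Term Γ where
    var : ∀ {s} → s ∈ Γ → Term Γ s
    app : ∀ {w s} → Fun Ω w s → Terms Γ w → Term Γ s

  data Terms Γ where
    []  : Terms Γ []
    _∷_ : ∀ {s w} → Term Γ s → Terms Γ w → Terms Γ (s ∷ w)

  GroundTerm : Sort Ω → Set
  GroundTerm = Term []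

  data Formula (Γ : List (Sort Ω)) : Set where
    tt ff   : Formula Γ
    equal   : ∀ {s} → Term Γ s → Term Γ s → Formula Γ
    atom    : ∀ {w} → Pred Ω w → Terms Γ w → Formula Γ
    neg     : Formula Γ → Formula Γ
    and or imp : Formula Γ → Formula Γ → Formula Γ
    all ex  : (s : Sort Ω) → Formula (s ∷ Γ) → Formula Γ

  Sentence : Set
  Sentence = Formula []

  Theory : Set₁
  Theory = Sentence → Set

  module _ (A : Structure) where

    eval  : ∀ {Γ s} → All (Carrier A) Γ → Term Γ s → Carrier A s
    evals : ∀ {Γ w} → All (Carrier A) Γ → Terms Γ w → All (Carrier A) w
    eval ρ (var x)    = All.lookup ρ x
    eval ρ (app f ts) = fun A f (evals ρ ts)
    evals ρ []       = []
    evals ρ (t ∷ ts) = eval ρ t ∷ evals ρ ts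

    value : ∀ {s} → GroundTerm s → Carrier A s
    value t = eval [] t

    Sat : ∀ {Γ} → All (Carrier A) Γ → Formula Γ → Set
    Sat ρ tt          = ⊤
    Sat ρ ff          = ⊥
    Sat ρ (equal t u) = eval ρ t ≡ eval ρ u
    Sat ρ (atom p ts) = pred A p (evals ρ ts)
    Sat ρ (neg φ)     = ¬ Sat ρ φ
    Sat ρ (and φ ψ)   = Sat ρ φ × Sat ρ ψ
    Sat ρ (or φ ψ)    = Sat ρ φ ⊎ Sat ρ ψ
    Sat ρ (imp φ ψ)   = Sat ρ φ → Sat ρ ψ
    Sat ρ (all s φ)   = (x : Carrier A s) → Sat (x ∷ ρ) φ
    Sat ρ (ex s φ)    = Σ (Carrier A s) λ x → Sat (x ∷ ρ) φ

    _⊨_ : Sentence → Set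
    _⊨_ φ = Sat [] φ

    IsModel : Theory → Set
    IsModel T = (φ : Sentence) → T φ → _⊨_ φ

  data K (s : Sort Ω) : Sort Ω → Set where
    base : K s s
    step : ∀ {w s' sᵢ} → Fun Ω w s' → K s s' → sᵢ ∈ w → K s sᵢ

  -- The carrier of the
  -- sort Nat is taken to be ℕ (hypothesis A_Nat = ℕ); the interpretation
  -- of the constant 0 and of > are fields (constrained in the theorem).
  -- 'term s'' interprets the predicate term_{s'} : s' Nat.

  record NatExpansion (s : Sort Ω) : Set₁ where
    field
      reduct : Structure
      zeroᴬ  : ℕ
      gtᴬ    : ℕ → ℕ → Set
      term   : (s' : Sort Ω) → Carrier reduct s' → ℕ → Set
  open NatExpansion public

  -- A ⊨ SuH_s : the satisfaction clauses of the sentences (i)–(iii),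
  -- for every s' ∈ K(s), written out.  (Disjunctions over symbols become
  -- existentials over symbols; the empty disjunction is then ⊥.)
  module _ {s : Sort Ω} (A : NatExpansion s) where
    private
      R = reduct A
      C = Carrier R

    SuH-i : (s' : Sort Ω) → Set
    SuH-i s' = (x : C s') → Σ ℕ λ n → term A s' x n

    SuH-ii : (s' : Sort Ω) → Set
    SuH-ii s' = (x : C s') (n : ℕ) →
      term A s' x (zeroᴬ A) → Σ (Fun Ω [] s') λ c → x ≡ fun R c []

    SuH-iii : (s' : Sort Ω) → Set
    SuH-iii s' = (x : C s') (n : ℕ) → Σ ℕ λ m →
      (gtᴬ A n (zeroᴬ A) × term A s' x n) →
        ( gtᴬ A n m
        × ( term A s' x m
          ⊎ Σ (Sort Ω) λ s₁ → Σ (List (Sort Ω)) λ w' →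
              Σ (Fun Ω (s₁ ∷ w') s') λ f →
              Σ (All C (s₁ ∷ w')) λ ys →
                x ≡ fun R f ys
                × (∀ {sᵢ} (i : sᵢ ∈ s₁ ∷ w') → term A sᵢ (All.lookup ys i) m)))

    ModelsSuH : Set
    ModelsSuH = (s' : Sort Ω) → K s s' → SuH-i s' × SuH-ii s' × SuH-iii s'

module Submission where

-- An element x "has rank n" when A ⊨ term_{s'}(x, n); by SuH (i) every
-- element has some rank.  We show, by strong induction on the rank, that
-- every element of a rank is denoted by a ground term:
--   * rank 0: SuH (ii) says x is (the value of) a constant;
--   * rank n > 0: SuH (iii) gives a smaller rank m < n such that either x
--     itself has rank m, or x = f(y₁,…,y_k) with every yᵢ of rank m; the
--     argument sorts of f lie in K(s) again, so the induction hypothesis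
--     denotes each yᵢ, and f applied to those terms denotes x.

open import Defs
open import Data.Nat using (ℕ; _>_; _<_; zero; suc; s≤s; z≤n)
open import Data.Nat.Induction using (<-rec)
open import Data.Product using (Σ; _×_; _,_)
open import Data.Sum using (_⊎_; inj₁; inj₂)
open import Data.List using (List; []; _∷_)
open import Data.List.Membership.Propositional using (_∈_)
open import Data.List.Relation.Unary.All as All using (All; []; _∷_)
open import Data.List.Relation.Unary.Any using (here; there)
open import Relation.Binary.PropositionalEquality using (_≡_; refl; sym; subst; cong; cong₂)
open import Function.Bundles using (_⇔_; Equivalence)

module Denotation {Ω : Signature} (M : Structure Ω) where

  Denoted : ∀ {s} → Carrier M s → Set
  Denoted {s} x = Σ (GroundTerm Ω s) λ t → value Ω M t ≡ x

  denoted-args : ∀ {w} (ys : All (Carrier M) w) →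
    (∀ {sᵢ} (i : sᵢ ∈ w) → Denoted (All.lookup ys i)) →
    Σ (Terms Ω [] w) λ ts → evals Ω M [] ts ≡ ys
  denoted-args []       _  = [] , refl
  denoted-args (y ∷ ys) ds with ds (here refl) | denoted-args ys (λ i → ds (there i))
  ... | t , t≡y | ts , ts≡ys = t ∷ ts , cong₂ _∷_ t≡y ts≡ys

  denoted-app : ∀ {w s} (f : Fun Ω w s) (ys : All (Carrier M) w) →
    (∀ {sᵢ} (i : sᵢ ∈ w) → Denoted (All.lookup ys i)) →
    Denoted (fun M f ys)
  denoted-app f ys ds with denoted-args ys ds
  ... | ts , ts≡ys = app f ts , cong (fun M f) ts≡ys

module Ranks {Ω : Signature} {s : Sort Ω} (A : NatExpansion Ω s)
  (zero-std : zeroᴬ A ≡ 0) (gt-std : (m n : ℕ) → gtᴬ A m n ⇔ m > n)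
  (suh : ModelsSuH Ω A) where

  open Denotation (reduct A)

  C : Sort Ω → Set
  C = Carrier (reduct A)

  DecomposesAt : ∀ {s'} → C s' → ℕ → Set
  DecomposesAt {s'} x m =
    Σ (Sort Ω) λ s₁ → Σ (List (Sort Ω)) λ w → Σ (Fun Ω (s₁ ∷ w) s') λ f →
    Σ (All C (s₁ ∷ w)) λ ys →
      x ≡ fun (reduct A) f ys
      × (∀ {sᵢ} (i : sᵢ ∈ s₁ ∷ w) → term A sᵢ (All.lookup ys i) m)

  rank-zero : ∀ {s'} → K Ω s s' → (x : C s') → term A s' x 0 →
    Σ (Fun Ω [] s') λ c → x ≡ fun (reduct A) c []
  rank-zero {s'} k x x₀ with suh s' k
  ... | _ , ii , _ = ii x 0 (subst (term A s' x) (sym zero-std) x₀)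

  rank-descent : ∀ {s'} → K Ω s s' → (x : C s') (n : ℕ) → term A s' x (suc n) →
    Σ ℕ λ m → m < suc n × (term A s' x m ⊎ DecomposesAt x m)
  rank-descent {s'} k x n xₙ with suh s' k
  ... | _ , _ , iii with iii x (suc n)
  ... | m , descend with descend (positive , xₙ)
    where
      positive : gtᴬ A (suc n) (zeroᴬ A)
      positive = subst (gtᴬ A (suc n)) (sym zero-std)
                       (Equivalence.from (gt-std (suc n) 0) (s≤s z≤n))
  ... | n>m , alternatives = m , Equivalence.to (gt-std (suc n) m) n>m , alternatives

  RankedDenoted : ℕ → Set
  RankedDenoted n = ∀ {s'} → K Ω s s' → (x : C s') → term A s' x n → Denoted x

  ranked⇒denoted : ∀ n → RankedDenoted n
  ranked⇒denoted = <-rec RankedDenoted induction-step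
    where
      induction-step : ∀ n → (∀ {m} → m < n → RankedDenoted m) → RankedDenoted n
      induction-step zero _ k x x₀ with rank-zero k x x₀
      ... | c , refl = denoted-app c [] (λ ())
      induction-step (suc n) ih k x xₙ with rank-descent k x n xₙ
      ... | m , m<n , inj₁ xₘ = ih m<n k x xₘ
      ... | m , m<n , inj₂ (_ , _ , f , ys , refl , ysₘ) =
        denoted-app f ys (λ i → ih m<n (step f k i) (All.lookup ys i) (ysₘ i))

proposition3 : (Ω : Signature) (𝒮 : Theory Ω) (s : Sort Ω)
    (A : NatExpansion Ω s) →
    IsModel Ω (reduct A) 𝒮 →
    zeroᴬ A ≡ 0 →
    ((m n : ℕ) → gtᴬ A m n ⇔ m > n) →
    ModelsSuH Ω A →
    (s' : Sort Ω) → K Ω s s' →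
    (a : Carrier (reduct A) s') →
    Σ (GroundTerm Ω s') λ t → value Ω (reduct A) t ≡ a
proposition3 Ω 𝒮 s A _ zero-std gt-std suh s' k a with suh s' k
... | has-rank , _ with has-rank a
... | n , aₙ = Ranks.ranked⇒denoted A zero-std gt-std suh n k a aₙ
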